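{- Let $m \geq 1$ and $0 \leq l \leq m$ be integers. Let $\lambda_l = \frac{1-(-1)^l}{2}$ and $M_0 = \left\lfloor \frac{m + \lambda_l}{2} \right\rfloor$. Then \[ \nu_2(A_{l,m}) = 2l - \lfloor l/2 \rfloor + \lambda_l\, \nu_2\big(M_0 - \lfloor l/2 \rfloor\big) + \nu_2\big(A_{\lfloor l/2 \rfloor,\, M_0}\big), \] where the term $\lambda_l \nu_2(\cdot)$ is interpreted as $0$ when $\lambda_l = 0$.
   Context: For integers $m \geq 0$ and $0 \leq l \leq m$, $A_{l,m} = \frac{l!\, m!}{2^{m-l}} \sum_{k=l}^{m} 2^{k} \binom{2m-2k}{m-k}\binom{m+k}{m}\binom{k}{l}$ (nonzero integers; $A_{0,0}=1$). $\nu_2$ denotes the $2$-adic valuation. -}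

module Defs where

open import Data.Nat using (ℕ; zero; suc; _+_; _*_; _∸_; _^_; _/_; _%_; _!)
open import Data.Nat.Combinatorics using (_C_)
open import Data.Nat.Properties using (_≟_; m^n≢0)
open import Data.List using (List; map; upTo)
open import Data.Nat.ListAction using (sum)
open import Relation.Nullary using (yes; no)

sumFromTo : ℕ → ℕ → (ℕ → ℕ) → ℕ
sumFromTo l m f = sum (map (λ i → f (l + i)) (upTo (suc (m ∸ l))))

-- A_{l,m} = l! m! / 2^{m-l} * Σ_{k=l}^{m} 2^k C(2m-2k, m-k) C(m+k, m) C(k, l)
-- (the quotient is exact: A_{l,m} is an integer for 0 ≤ l ≤ m)
A : ℕ → ℕ → ℕ
A l m = ((l !) * (m !) * sumFromTo l m
          (λ k → 2 ^ k * ((2 * m ∸ 2 * k) C (m ∸ k)) * ((m + k) C m) * (k C l)))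
        / (2 ^ (m ∸ l))
  where instance _ = m^n≢0 2 (m ∸ l)

-- 2-adic valuation with fuel; ν₂ n is correct for n ≥ 1 (ν₂ 0 = 0 by convention)
ν₂-fuel : ℕ → ℕ → ℕ
ν₂-fuel zero n = 0
ν₂-fuel (suc f) zero = 0
ν₂-fuel (suc f) (suc n) with (suc n) % 2 ≟ 0
... | yes _ = suc (ν₂-fuel f ((suc n) / 2))
... | no _ = 0

ν₂ : ℕ → ℕ
ν₂ n = ν₂-fuel n n

-- λ_l = (1 - (-1)^l)/2, i.e. l mod 2
lam : ℕ → ℕ
lam l = l % 2

-- Writing m = l + n and re-indexing the sum by i = k − l, j = n − i, every summand of
-- l! m! Σ_k ... becomes 2^(l+n) (2j−1)!! (m+l+i)!/(i! j!), so A_{l,m} = 2^l C with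
-- n! C = (m+l)! r, where r = Σ_i (2(n−i)−1)!! C(n,i) (m+l+1)···(m+l+i).  The i = 0 term of r is
-- the odd number (2n−1)!!, the i = 1 term contains n (2l+n+1) and the others contain two
-- consecutive factors, so r is odd and ν₂(A_{l,m}) = l + ν₂((m+l)!) − ν₂((m−l)!).
-- Legendre's relation ν₂((2q+r)!) = q + ν₂(q!) for r < 2 rewrites both sides of the
-- proposition in these terms, and they agree by linear arithmetic.
module Submission where

open import Defs
open import Data.Nat using (ℕ; zero; suc; _+_; _*_; _∸_; _≤_; _<_; _/_; _%_; _^_; _!; z≤n; s≤s; NonZero)
open import Data.Nat.Properties
open import Data.Nat.DivMod
open import Data.Nat.Divisibility
open import Data.Nat.Combinatorics using (_C_; nCk≡n!/k![n-k]!; k![n∸k]!∣n!; nC1≡n)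
open import Data.List using ([]; _∷_; map; upTo)
open import Data.List.Properties using (map-cong-local)
open import Data.List.Relation.Unary.All using (All; []; _∷_)
open import Data.List.Relation.Unary.All.Properties using (map⁺; applyUpTo⁺₁)
open import Data.Nat.ListAction using (sum)
open import Data.Nat.Primality using (Prime; prime?; euclidsLemma)
open import Data.Nat.Induction using (<-rec)
open import Data.Nat.Tactic.RingSolver using (solve-∀)
open import Function using (_∘_)
open import Data.Product using (∃₂; _×_; _,_)
open import Data.Sum using (inj₁; inj₂)
open import Relation.Nullary using (yes; no; contradiction)
open import Relation.Nullary.Decidable using (from-yes)
open import Relation.Binary.PropositionalEquality using (_≡_; refl; sym; trans; subst; cong; cong₂; module ≡-Reasoning)

2-prime : Prime 2
2-prime = from-yes (prime? 2)

2∤1 : 2 ∤ 1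
2∤1 2∣1 with ∣1⇒≡1 2∣1
... | ()

2∤1+n*2 : ∀ n → 2 ∤ suc (n * 2)
2∤1+n*2 n 2∣ = 2∤1 (∣m+n∣m⇒∣n (subst (2 ∣_) (+-comm 1 (n * 2)) 2∣) (n∣m*n n))

2∤*2∤⇒2∤* : ∀ {m n} → 2 ∤ m → 2 ∤ n → 2 ∤ m * n
2∤*2∤⇒2∤* {m} {n} 2∤m 2∤n 2∣mn with euclidsLemma m n 2-prime 2∣mn
... | inj₁ 2∣m = 2∤m 2∣m
... | inj₂ 2∣n = 2∤n 2∣n

2∤+2∣⇒2∤+ : ∀ {m n} → 2 ∤ m → 2 ∣ n → 2 ∤ m + n
2∤+2∣⇒2∤+ {m} {n} 2∤m 2∣n 2∣m+n = 2∤m (∣m+n∣m⇒∣n (subst (2 ∣_) (+-comm m n) 2∣m+n) 2∣n)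

2∤⇒≢0 : ∀ {n} → 2 ∤ n → NonZero n
2∤⇒≢0 {zero}  2∤n = contradiction (2 ∣0) 2∤n
2∤⇒≢0 {suc n} _   = _

2∣n*[1+n] : ∀ n → 2 ∣ n * suc n
2∣n*[1+n] zero = 2 ∣0
2∣n*[1+n] (suc n) = subst (2 ∣_) (sym (split n)) (∣m∣n⇒∣m+n (2∣n*[1+n] n) (n∣m*n (suc n)))
  where split : ∀ n → suc n * suc (suc n) ≡ n * suc n + suc n * 2
        split = solve-∀

ν₂-fuel-odd : ∀ f n → 2 ∤ suc n → ν₂-fuel (suc f) (suc n) ≡ 0
ν₂-fuel-odd f n 2∤ with suc n % 2 ≟ 0
... | yes r = contradiction (m%n≡0⇒n∣m (suc n) 2 r) 2∤
... | no _  = refl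

ν₂-fuel-even : ∀ f n → 2 ∣ suc n → ν₂-fuel (suc f) (suc n) ≡ suc (ν₂-fuel f (suc n / 2))
ν₂-fuel-even f n 2∣ with suc n % 2 ≟ 0
... | yes _ = refl
... | no r  = contradiction (n∣m⇒m%n≡0 (suc n) 2 2∣) r

ν₂-fuel-*2 : ∀ x {a} f .{{_ : NonZero x}} → (∀ g → x ≤ g → ν₂-fuel g x ≡ a) →
             x * 2 ≤ f → ν₂-fuel f (x * 2) ≡ suc a
ν₂-fuel-*2 (suc y) {a} (suc f) ν₂x x*2≤f = begin
    ν₂-fuel (suc f) (suc y * 2)       ≡⟨ ν₂-fuel-even f (suc (y * 2)) (n∣m*n (suc y)) ⟩
    suc (ν₂-fuel f (suc y * 2 / 2))   ≡⟨ cong (suc ∘ ν₂-fuel f) (m*n/n≡m (suc y) 2) ⟩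
    suc (ν₂-fuel f (suc y))           ≡⟨ cong suc (ν₂x f (≤-trans (s≤s (m≤m*n y 2)) (≤-pred x*2≤f))) ⟩
    suc a                             ∎
  where open ≡-Reasoning

ν₂-fuel-2^*odd : ∀ a {o} f → 2 ∤ o → 2 ^ a * o ≤ f → ν₂-fuel f (2 ^ a * o) ≡ a
ν₂-fuel-2^*odd zero    {suc o} (suc f) 2∤o _ rewrite +-identityʳ o = ν₂-fuel-odd f o 2∤o
ν₂-fuel-2^*odd zero    {zero}  f       2∤o _ = contradiction (2 ∣0) 2∤o
ν₂-fuel-2^*odd (suc a) {o}     f       2∤o ≤f =
  subst (λ x → ν₂-fuel f x ≡ suc a) (sym 2^[1+a]*o≡2^a*o*2)
    (ν₂-fuel-*2 (2 ^ a * o) f {{x≢0}} (λ g → ν₂-fuel-2^*odd a g 2∤o) (subst (_≤ f) 2^[1+a]*o≡2^a*o*2 ≤f))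
  where
  x≢0 : NonZero (2 ^ a * o)
  x≢0 = m*n≢0 (2 ^ a) o {{m^n≢0 2 a}} {{2∤⇒≢0 2∤o}}
  2^[1+a]*o≡2^a*o*2 : 2 ^ suc a * o ≡ 2 ^ a * o * 2
  2^[1+a]*o≡2^a*o*2 = trans (*-assoc 2 (2 ^ a) o) (*-comm 2 (2 ^ a * o))

ν₂-2^*odd : ∀ a {o} → 2 ∤ o → ν₂ (2 ^ a * o) ≡ a
ν₂-2^*odd a {o} 2∤o = ν₂-fuel-2^*odd a (2 ^ a * o) 2∤o ≤-refl

2-adic-form : ∀ n .{{_ : NonZero n}} → ∃₂ λ a o → 2 ∤ o × n ≡ 2 ^ a * o
2-adic-form = <-rec (λ n → .{{_ : NonZero n}} → ∃₂ λ a o → 2 ∤ o × n ≡ 2 ^ a * o) split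
  where
  split : ∀ n → (∀ {q} → q < n → .{{_ : NonZero q}} → ∃₂ λ a o → 2 ∤ o × q ≡ 2 ^ a * o) →
          .{{_ : NonZero n}} → ∃₂ λ a o → 2 ∤ o × n ≡ 2 ^ a * o
  split n smaller with 2 ∣? n
  ... | no 2∤n = 0 , n , 2∤n , sym (*-identityˡ n)
  ... | yes (divides q refl) with smaller (m<m*n q 2 {{q≢0}} (s≤s (s≤s z≤n))) {{q≢0}}
    where q≢0 : NonZero q
          q≢0 = m*n≢0⇒m≢0 q
  ...   | a , o , 2∤o , refl = suc a , o , 2∤o , trans (*-comm (2 ^ a * o) 2) (sym (*-assoc 2 (2 ^ a) o))

ν₂-* : ∀ m n .{{_ : NonZero m}} .{{_ : NonZero n}} → ν₂ (m * n) ≡ ν₂ m + ν₂ n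
ν₂-* m n with 2-adic-form m | 2-adic-form n
... | a , o , 2∤o , refl | b , p , 2∤p , refl = begin
    ν₂ (2 ^ a * o * (2 ^ b * p))    ≡⟨ cong ν₂ (regroup (2 ^ a) (2 ^ b) o p) ⟩
    ν₂ (2 ^ a * 2 ^ b * (o * p))    ≡⟨ cong (λ x → ν₂ (x * (o * p))) (^-distribˡ-+-* 2 a b) ⟨
    ν₂ (2 ^ (a + b) * (o * p))      ≡⟨ ν₂-2^*odd (a + b) (2∤*2∤⇒2∤* 2∤o 2∤p) ⟩
    a + b                           ≡⟨ cong₂ _+_ (ν₂-2^*odd a 2∤o) (ν₂-2^*odd b 2∤p) ⟨
    ν₂ (2 ^ a * o) + ν₂ (2 ^ b * p) ∎
  where
  open ≡-Reasoning
  regroup : ∀ x y o p → x * o * (y * p) ≡ x * y * (o * p)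
  regroup = solve-∀

ν₂-odd : ∀ {n} → 2 ∤ n → ν₂ n ≡ 0
ν₂-odd {n} 2∤n = subst (λ x → ν₂ x ≡ 0) (*-identityˡ n) (ν₂-2^*odd 0 2∤n)

ν₂-2^ : ∀ a → ν₂ (2 ^ a) ≡ a
ν₂-2^ a = subst (λ x → ν₂ x ≡ a) (*-identityʳ (2 ^ a)) (ν₂-2^*odd a 2∤1)

oddFactorial : ℕ → ℕ
oddFactorial zero    = 1
oddFactorial (suc k) = suc (k * 2) * oddFactorial k

2∤oddFactorial : ∀ k → 2 ∤ oddFactorial k
2∤oddFactorial zero    = 2∤1
2∤oddFactorial (suc k) = 2∤*2∤⇒2∤* (2∤1+n*2 k) (2∤oddFactorial k)

[k*2]!≡2^k*k!*oddFactorial : ∀ k → (k * 2) ! ≡ 2 ^ k * k ! * oddFactorial k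
[k*2]!≡2^k*k!*oddFactorial zero    = refl
[k*2]!≡2^k*k!*oddFactorial (suc k) =
  trans (cong (λ x → suc (suc (k * 2)) * (suc (k * 2) * x)) ([k*2]!≡2^k*k!*oddFactorial k))
        (regroup k (2 ^ k) (k !) (oddFactorial k))
  where
  regroup : ∀ k p f d → suc (suc (k * 2)) * (suc (k * 2) * (p * f * d)) ≡ 2 * p * (suc k * f) * (suc (k * 2) * d)
  regroup = solve-∀

ν₂-[k*2]! : ∀ k → ν₂ ((k * 2) !) ≡ k + ν₂ (k !)
ν₂-[k*2]! k = begin
    ν₂ ((k * 2) !)                           ≡⟨ cong ν₂ ([k*2]!≡2^k*k!*oddFactorial k) ⟩
    ν₂ (2 ^ k * k ! * oddFactorial k)        ≡⟨ ν₂-* (2 ^ k * k !) (oddFactorial k) {{2^k*k!≢0}} {{2∤⇒≢0 (2∤oddFactorial k)}} ⟩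
    ν₂ (2 ^ k * k !) + ν₂ (oddFactorial k)   ≡⟨ cong₂ _+_ (ν₂-* (2 ^ k) (k !) {{m^n≢0 2 k}} {{k !≢0}})
                                                          (ν₂-odd (2∤oddFactorial k)) ⟩
    ν₂ (2 ^ k) + ν₂ (k !) + 0                ≡⟨ trans (+-identityʳ _) (cong (_+ ν₂ (k !)) (ν₂-2^ k)) ⟩
    k + ν₂ (k !)                             ∎
  where
  open ≡-Reasoning
  2^k*k!≢0 : NonZero (2 ^ k * k !)
  2^k*k!≢0 = m*n≢0 (2 ^ k) (k !) {{m^n≢0 2 k}} {{k !≢0}}

ν₂-[1+n]! : ∀ n → ν₂ (suc n !) ≡ ν₂ (suc n) + ν₂ (n !)
ν₂-[1+n]! n = ν₂-* (suc n) (n !) {{_}} {{n !≢0}}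

ν₂-[r+k*2]! : ∀ {r} k → r < 2 → ν₂ ((r + k * 2) !) ≡ k + ν₂ (k !)
ν₂-[r+k*2]! k (s≤s z≤n)       = ν₂-[k*2]! k
ν₂-[r+k*2]! k (s≤s (s≤s z≤n)) = trans (ν₂-[1+n]! (k * 2)) (cong₂ _+_ (ν₂-odd (2∤1+n*2 k)) (ν₂-[k*2]! k))

rising : ℕ → ℕ → ℕ
rising a zero    = 1
rising a (suc t) = suc (a + t) * rising a t

a!*rising≡[a+t]! : ∀ a t → a ! * rising a t ≡ (a + t) !
a!*rising≡[a+t]! a zero    = trans (*-identityʳ (a !)) (cong _! (sym (+-identityʳ a)))
a!*rising≡[a+t]! a (suc t) = begin
    a ! * (suc (a + t) * rising a t)   ≡⟨ *-comm (a !) _ ⟩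
    suc (a + t) * rising a t * a !     ≡⟨ *-assoc (suc (a + t)) (rising a t) (a !) ⟩
    suc (a + t) * (rising a t * a !)   ≡⟨ cong (suc (a + t) *_) (trans (*-comm _ (a !)) (a!*rising≡[a+t]! a t)) ⟩
    suc (a + t) !                      ≡⟨ cong _! (+-suc a t) ⟨
    (a + suc t) !                      ∎
  where open ≡-Reasoning

2∣rising[2+t] : ∀ a t → 2 ∣ rising a (suc (suc t))
2∣rising[2+t] a t = subst (2 ∣_) (*-assoc (suc (a + suc t)) (suc (a + t)) (rising a t))
                      (∣m⇒∣m*n (rising a t) consecutive)
  where
  consecutive : 2 ∣ suc (a + suc t) * suc (a + t)
  consecutive = subst (λ x → 2 ∣ suc x * suc (a + t)) (sym (+-suc a t))
                  (subst (2 ∣_) (*-comm (suc (a + t)) _) (2∣n*[1+n] (suc (a + t))))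

[m+n]Cm*[m!*n!]≡[m+n]! : ∀ m n → ((m + n) C m) * (m ! * n !) ≡ (m + n) !
[m+n]Cm*[m!*n!]≡[m+n]! m n = begin
    ((m + n) C m) * (m ! * n !)                 ≡⟨ cong (λ x → ((m + n) C m) * (m ! * x !)) (m+n∸m≡n m n) ⟨
    ((m + n) C m) * (m ! * (m + n ∸ m) !)       ≡⟨ cong (_* (m ! * (m + n ∸ m) !)) (nCk≡n!/k![n-k]! (m≤m+n m n)) ⟩
    (m + n) ! / (m ! * (m + n ∸ m) !) * _     ≡⟨ m/n*n≡m (k![n∸k]!∣n! (m≤m+n m n)) ⟩
    (m + n) !                                 ∎
  where
  open ≡-Reasoning
  instance _ = m !* (m + n ∸ m) !≢0

sum-map-*ˡ : ∀ c (f : ℕ → ℕ) xs → sum (map (λ x → c * f x) xs) ≡ c * sum (map f xs)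
sum-map-*ˡ c f []       = sym (*-zeroʳ c)
sum-map-*ˡ c f (x ∷ xs) = trans (cong (c * f x +_) (sum-map-*ˡ c f xs)) (sym (*-distribˡ-+ c (f x) _))

∣-sum : ∀ {d xs} → All (d ∣_) xs → d ∣ sum xs
∣-sum []         = _ ∣0
∣-sum (d∣x ∷ ds) = ∣m∣n⇒∣m+n d∣x (∣-sum ds)

sumFromTo-*ˡ : ∀ c l m f → sumFromTo l m (λ k → c * f k) ≡ c * sumFromTo l m f
sumFromTo-*ˡ c l m f = sum-map-*ˡ c (λ i → f (l + i)) (upTo (suc (m ∸ l)))

sumFromTo-shift : ∀ l n f → sumFromTo l (l + n) f ≡ sumFromTo 0 n (λ i → f (l + i))
sumFromTo-shift l n f = cong (λ k → sum (map (λ i → f (l + i)) (upTo (suc k)))) (m+n∸m≡n l n)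

sumFromTo-cong : ∀ n {f g} → (∀ {i} → i ≤ n → f i ≡ g i) → sumFromTo 0 n f ≡ sumFromTo 0 n g
sumFromTo-cong n f≡g = cong sum (map-cong-local (applyUpTo⁺₁ (λ i → i) (suc n) (λ i<1+n → f≡g (≤-pred i<1+n))))

2∤sumFromTo : ∀ n {f} → 2 ∤ f 0 → (∀ {i} → i < n → 2 ∣ f (suc i)) → 2 ∤ sumFromTo 0 n f
2∤sumFromTo n 2∤f0 2∣f = 2∤+2∣⇒2∤+ 2∤f0 (∣-sum (map⁺ (applyUpTo⁺₁ suc n 2∣f)))

[j*2]Cj*j!≡2^j*oddFactorial : ∀ j → ((j * 2) C j) * j ! ≡ 2 ^ j * oddFactorial j
[j*2]Cj*j!≡2^j*oddFactorial j = *-cancelʳ-≡ _ _ (j !) {{j !≢0}} (begin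
    ((j * 2) C j) * j ! * j !          ≡⟨ *-assoc ((j * 2) C j) (j !) (j !) ⟩
    ((j * 2) C j) * (j ! * j !)        ≡⟨ cong (λ x → (x C j) * (j ! * j !)) j*2≡j+j ⟩
    ((j + j) C j) * (j ! * j !)        ≡⟨ [m+n]Cm*[m!*n!]≡[m+n]! j j ⟩
    (j + j) !                          ≡⟨ cong _! j*2≡j+j ⟨
    (j * 2) !                          ≡⟨ [k*2]!≡2^k*k!*oddFactorial j ⟩
    2 ^ j * j ! * oddFactorial j       ≡⟨ *-assoc (2 ^ j) (j !) _ ⟩
    2 ^ j * (j ! * oddFactorial j)     ≡⟨ cong (2 ^ j *_) (*-comm (j !) _) ⟩
    2 ^ j * (oddFactorial j * j !)     ≡⟨ *-assoc (2 ^ j) _ (j !) ⟨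
    2 ^ j * oddFactorial j * j !       ∎)
  where
  open ≡-Reasoning
  j*2≡j+j : j * 2 ≡ j + j
  j*2≡j+j = trans (*-comm j 2) (cong (j +_) (+-identityʳ j))

Aterm : ℕ → ℕ → ℕ → ℕ
Aterm l m k = 2 ^ k * ((2 * m ∸ 2 * k) C (m ∸ k)) * ((m + k) C m) * (k C l)

-- (2j−1)!! (m+l+i)! / (i! j!) for m = l + n and j = n − i, written without division.
cofactorTerm : ℕ → ℕ → ℕ → ℕ
cofactorTerm l n i = oddFactorial (n ∸ i) * (n C i) * rising n (l + l + i)

cofactor : ℕ → ℕ → ℕ
cofactor l n = sumFromTo 0 n (cofactorTerm l n)

oddPartTerm : ℕ → ℕ → ℕ → ℕ
oddPartTerm l n i = oddFactorial (n ∸ i) * (n C i) * rising (l + n + l) i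

oddPart : ℕ → ℕ → ℕ
oddPart l n = sumFromTo 0 n (oddPartTerm l n)

Aterm-cleared : ∀ l i j → l ! * (l + (i + j)) ! * Aterm l (l + (i + j)) (l + i) * (i ! * j !)
                ≡ 2 ^ (l + i + j) * oddFactorial j * (l + (i + j) + (l + i)) !
Aterm-cleared l i j = begin
    l ! * m ! * Aterm l m k * (i ! * j !)
  ≡⟨ cong₂ (λ a b → l ! * m ! * (2 ^ k * (a C b) * ((m + k) C m) * (k C l)) * (i ! * j !)) 2m∸2k≡j*2 m∸k≡j ⟩
    l ! * m ! * (2 ^ k * ((j * 2) C j) * ((m + k) C m) * (k C l)) * (i ! * j !)
  ≡⟨ regroup (l !) (m !) (i !) (j !) (2 ^ k) ((j * 2) C j) ((m + k) C m) (k C l) ⟩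
    2 ^ k * (((j * 2) C j) * j !) * (((m + k) C m) * (m ! * ((k C l) * (l ! * i !))))
  ≡⟨ cong₂ (λ a b → 2 ^ k * a * (((m + k) C m) * (m ! * b)))
           ([j*2]Cj*j!≡2^j*oddFactorial j) ([m+n]Cm*[m!*n!]≡[m+n]! l i) ⟩
    2 ^ k * (2 ^ j * oddFactorial j) * (((m + k) C m) * (m ! * k !))
  ≡⟨ cong (2 ^ k * (2 ^ j * oddFactorial j) *_) ([m+n]Cm*[m!*n!]≡[m+n]! m k) ⟩
    2 ^ k * (2 ^ j * oddFactorial j) * (m + k) !
  ≡⟨ cong (_* (m + k) !) (*-assoc (2 ^ k) (2 ^ j) (oddFactorial j)) ⟨
    2 ^ k * 2 ^ j * oddFactorial j * (m + k) !
  ≡⟨ cong (λ x → x * oddFactorial j * (m + k) !) (^-distribˡ-+-* 2 k j) ⟨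
    2 ^ (k + j) * oddFactorial j * (m + k) !
  ∎
  where
  open ≡-Reasoning
  m k : ℕ
  m = l + (i + j)
  k = l + i
  m∸k≡j : m ∸ k ≡ j
  m∸k≡j = trans (cong (_∸ k) (sym (+-assoc l i j))) (m+n∸m≡n k j)
  2m∸2k≡j*2 : 2 * m ∸ 2 * k ≡ j * 2
  2m∸2k≡j*2 = trans (sym (*-distribˡ-∸ 2 m k)) (trans (cong (2 *_) m∸k≡j) (*-comm 2 j))
  regroup : ∀ fl fm fi fj p cj cm cl →
    fl * fm * (p * cj * cm * cl) * (fi * fj) ≡ p * (cj * fj) * (cm * (fm * (cl * (fl * fi))))
  regroup = solve-∀

closedTerm-cleared : ∀ l i j → 2 ^ (i + j) * (2 ^ l * (oddFactorial j * ((i + j) C i) * rising (i + j) (l + l + i))) * (i ! * j !)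
                     ≡ 2 ^ (l + i + j) * oddFactorial j * (l + (i + j) + (l + i)) !
closedTerm-cleared l i j = begin
    2 ^ n * (2 ^ l * (oddFactorial j * (n C i) * rising n (l + l + i))) * (i ! * j !)
  ≡⟨ regroup (2 ^ n) (2 ^ l) (oddFactorial j) (n C i) (rising n (l + l + i)) (i !) (j !) ⟩
    2 ^ n * 2 ^ l * oddFactorial j * ((n C i) * (i ! * j !) * rising n (l + l + i))
  ≡⟨ cong (λ a → 2 ^ n * 2 ^ l * oddFactorial j * (a * rising n (l + l + i))) ([m+n]Cm*[m!*n!]≡[m+n]! i j) ⟩
    2 ^ n * 2 ^ l * oddFactorial j * (n ! * rising n (l + l + i))
  ≡⟨ cong₂ (λ a b → a * oddFactorial j * b) (sym (^-distribˡ-+-* 2 n l)) (a!*rising≡[a+t]! n (l + l + i)) ⟩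
    2 ^ (n + l) * oddFactorial j * (n + (l + l + i)) !
  ≡⟨ cong₂ (λ a b → 2 ^ a * oddFactorial j * b !) (exponent l i j) (factorialArg l i j) ⟩
    2 ^ (l + i + j) * oddFactorial j * (l + (i + j) + (l + i)) !
  ∎
  where
  open ≡-Reasoning
  n : ℕ
  n = i + j
  regroup : ∀ p q d c r fi fj → p * (q * (d * c * r)) * (fi * fj) ≡ p * q * d * (c * (fi * fj) * r)
  regroup = solve-∀
  exponent : ∀ l i j → i + j + l ≡ l + i + j
  exponent = solve-∀
  factorialArg : ∀ l i j → i + j + (l + l + i) ≡ l + (i + j) + (l + i)
  factorialArg = solve-∀

Aterm-closed : ∀ l i j → l ! * (l + (i + j)) ! * Aterm l (l + (i + j)) (l + i)
               ≡ 2 ^ (i + j) * (2 ^ l * (oddFactorial j * ((i + j) C i) * rising (i + j) (l + l + i)))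
Aterm-closed l i j = *-cancelʳ-≡ _ _ (i ! * j !) {{i !* j !≢0}}
  (trans (Aterm-cleared l i j) (sym (closedTerm-cleared l i j)))

Aterm-sum : ∀ l n → l ! * (l + n) ! * sumFromTo l (l + n) (Aterm l (l + n)) ≡ 2 ^ n * (2 ^ l * cofactor l n)
Aterm-sum l n = begin
    c * sumFromTo l (l + n) (Aterm l (l + n))                  ≡⟨ cong (c *_) (sumFromTo-shift l n (Aterm l (l + n))) ⟩
    c * sumFromTo 0 n (λ i → Aterm l (l + n) (l + i))          ≡⟨ sumFromTo-*ˡ c 0 n _ ⟨
    sumFromTo 0 n (λ i → c * Aterm l (l + n) (l + i))          ≡⟨ sumFromTo-cong n termwise ⟩
    sumFromTo 0 n (λ i → 2 ^ n * (2 ^ l * cofactorTerm l n i)) ≡⟨ sumFromTo-*ˡ (2 ^ n) 0 n _ ⟩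
    2 ^ n * sumFromTo 0 n (λ i → 2 ^ l * cofactorTerm l n i)   ≡⟨ cong (2 ^ n *_) (sumFromTo-*ˡ (2 ^ l) 0 n _) ⟩
    2 ^ n * (2 ^ l * cofactor l n)                             ∎
  where
  open ≡-Reasoning
  c : ℕ
  c = l ! * (l + n) !
  termwise : ∀ {i} → i ≤ n → c * Aterm l (l + n) (l + i) ≡ 2 ^ n * (2 ^ l * cofactorTerm l n i)
  termwise {i} i≤n with m≤n⇒∃[o]m+o≡n i≤n
  ... | j , refl = trans (Aterm-closed l i j)
    (cong (λ x → 2 ^ n * (2 ^ l * (oddFactorial x * (n C i) * rising n (l + l + i)))) (sym (m+n∸m≡n i j)))

A≡2^l*cofactor : ∀ l n → A l (l + n) ≡ 2 ^ l * cofactor l n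
A≡2^l*cofactor l n = begin
    A l (l + n)                                       ≡⟨ /-congˡ (Aterm-sum l n) ⟩
    2 ^ n * (2 ^ l * cofactor l n) / 2 ^ (l + n ∸ l)  ≡⟨ /-congʳ (cong (2 ^_) (m+n∸m≡n l n)) ⟩
    2 ^ n * (2 ^ l * cofactor l n) / 2 ^ n            ≡⟨ /-congˡ (*-comm (2 ^ n) _) ⟩
    2 ^ l * cofactor l n * 2 ^ n / 2 ^ n              ≡⟨ m*n/n≡m _ (2 ^ n) ⟩
    2 ^ l * cofactor l n                              ∎
  where
  open ≡-Reasoning
  instance
    _ = m^n≢0 2 n
    _ = m^n≢0 2 (l + n ∸ l)

n!*cofactor≡[l+n+l]!*oddPart : ∀ l n → n ! * cofactor l n ≡ (l + n + l) ! * oddPart l n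
n!*cofactor≡[l+n+l]!*oddPart l n = begin
    n ! * cofactor l n                                   ≡⟨ sumFromTo-*ˡ (n !) 0 n _ ⟨
    sumFromTo 0 n (λ i → n ! * cofactorTerm l n i)       ≡⟨ sumFromTo-cong n (λ {i} _ → termwise i) ⟩
    sumFromTo 0 n (λ i → (l + n + l) ! * oddPartTerm l n i) ≡⟨ sumFromTo-*ˡ ((l + n + l) !) 0 n _ ⟩
    (l + n + l) ! * oddPart l n                          ∎
  where
  open ≡-Reasoning
  moveIn : ∀ x a b c → x * (a * b * c) ≡ a * b * (x * c)
  moveIn = solve-∀
  factorialArg : ∀ l n i → n + (l + l + i) ≡ l + n + l + i
  factorialArg = solve-∀
  termwise : ∀ i → n ! * cofactorTerm l n i ≡ (l + n + l) ! * oddPartTerm l n i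
  termwise i = begin
      n ! * (d * c * rising n (l + l + i))         ≡⟨ moveIn (n !) d c _ ⟩
      d * c * (n ! * rising n (l + l + i))         ≡⟨ cong (d * c *_) (a!*rising≡[a+t]! n (l + l + i)) ⟩
      d * c * (n + (l + l + i)) !                  ≡⟨ cong (λ x → d * c * x !) (factorialArg l n i) ⟩
      d * c * (l + n + l + i) !                    ≡⟨ cong (d * c *_) (a!*rising≡[a+t]! (l + n + l) i) ⟨
      d * c * ((l + n + l) ! * rising (l + n + l) i) ≡⟨ moveIn ((l + n + l) !) d c _ ⟨
      (l + n + l) ! * (d * c * rising (l + n + l) i) ∎
    where
    d c : ℕ
    d = oddFactorial (n ∸ i)
    c = n C i

2∤oddPart : ∀ l n → 2 ∤ oddPart l n
2∤oddPart l n = 2∤sumFromTo n 2∤first 2∣later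
  where
  2∤first : 2 ∤ oddFactorial n * 1 * 1
  2∤first = subst (2 ∤_) (sym (trans (*-identityʳ _) (*-identityʳ _))) (2∤oddFactorial n)
  2∣n*[1+l+n+l] : 2 ∣ n * suc (l + n + l + 0)
  2∣n*[1+l+n+l] = subst (2 ∣_) (sym (split l n)) (∣m∣n⇒∣m+n (2∣n*[1+n] n) (n∣m*n (n * l)))
    where split : ∀ l n → n * suc (l + n + l + 0) ≡ n * suc n + n * l * 2
          split = solve-∀
  2∣later : ∀ {i} → i < n → 2 ∣ oddPartTerm l n (suc i)
  2∣later {zero} _ = subst (2 ∣_) (sym (*-assoc (oddFactorial (n ∸ 1)) (n C 1) (rising (l + n + l) 1)))
    (∣n⇒∣m*n (oddFactorial (n ∸ 1)) 2∣nC1*rising)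
    where
    2∣nC1*rising : 2 ∣ (n C 1) * rising (l + n + l) 1
    2∣nC1*rising = subst (λ x → 2 ∣ x * rising (l + n + l) 1) (sym (nC1≡n n))
                     (subst (λ y → 2 ∣ n * y) (sym (*-identityʳ _)) 2∣n*[1+l+n+l])
  2∣later {suc i} _ = ∣n⇒∣m*n (oddFactorial (n ∸ suc (suc i)) * (n C suc (suc i))) (2∣rising[2+t] (l + n + l) i)

ν₂-A : ∀ l n → ν₂ (A l (l + n)) + ν₂ (n !) ≡ l + ν₂ ((l + n + l) !)
ν₂-A l n = begin
    ν₂ (A l (l + n)) + ν₂ (n !)             ≡⟨ cong (λ x → ν₂ x + ν₂ (n !)) (A≡2^l*cofactor l n) ⟩
    ν₂ (2 ^ l * c) + ν₂ (n !)               ≡⟨ cong (_+ ν₂ (n !)) (ν₂-* (2 ^ l) c {{m^n≢0 2 l}}) ⟩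
    ν₂ (2 ^ l) + ν₂ c + ν₂ (n !)            ≡⟨ cong (λ x → x + ν₂ c + ν₂ (n !)) (ν₂-2^ l) ⟩
    l + ν₂ c + ν₂ (n !)                     ≡⟨ +-assoc l (ν₂ c) _ ⟩
    l + (ν₂ c + ν₂ (n !))                   ≡⟨ cong (l +_) (+-comm (ν₂ c) _) ⟩
    l + (ν₂ (n !) + ν₂ c)                   ≡⟨ cong (l +_) (ν₂-* (n !) c {{n !≢0}}) ⟨
    l + ν₂ (n ! * c)                        ≡⟨ cong (λ x → l + ν₂ x) (n!*cofactor≡[l+n+l]!*oddPart l n) ⟩
    l + ν₂ ((l + n + l) ! * r)              ≡⟨ cong (l +_) (ν₂-* ((l + n + l) !) r {{(l + n + l) !≢0}}) ⟩
    l + (ν₂ ((l + n + l) !) + ν₂ r)         ≡⟨ cong (λ x → l + (ν₂ ((l + n + l) !) + x)) (ν₂-odd (2∤oddPart l n)) ⟩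
    l + (ν₂ ((l + n + l) !) + 0)            ≡⟨ cong (l +_) (+-identityʳ _) ⟩
    l + ν₂ ((l + n + l) !)                  ∎
  where
  open ≡-Reasoning
  c r : ℕ
  c = cofactor l n
  r = oddPart l n
  instance
    r≢0 : NonZero r
    r≢0 = 2∤⇒≢0 (2∤oddPart l n)
    c≢0 : NonZero c
    c≢0 = m*n≢0⇒n≢0 (n !) {{subst NonZero (sym (n!*cofactor≡[l+n+l]!*oddPart l n))
                             (m*n≢0 ((l + n + l) !) r {{(l + n + l) !≢0}})}}

ν₂-[d+t]! : ∀ d {t} → t < 2 → ν₂ ((d + t) !) ≡ t * ν₂ (d + t) + ν₂ (d !)
ν₂-[d+t]! d (s≤s z≤n)       = cong (ν₂ ∘ _!) (+-identityʳ d)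
ν₂-[d+t]! d (s≤s (s≤s z≤n)) = begin
    ν₂ ((d + 1) !)            ≡⟨ cong (ν₂ ∘ _!) (+-comm d 1) ⟩
    ν₂ (suc d !)              ≡⟨ ν₂-[1+n]! d ⟩
    ν₂ (suc d) + ν₂ (d !)     ≡⟨ cong (λ x → ν₂ x + ν₂ (d !)) (+-comm 1 d) ⟩
    ν₂ (d + 1) + ν₂ (d !)     ≡⟨ cong (_+ ν₂ (d !)) (*-identityˡ (ν₂ (d + 1))) ⟨
    1 * ν₂ (d + 1) + ν₂ (d !) ∎
  where open ≡-Reasoning

ν₂-A-halving : ∀ h {t} d {s} → t < 2 → s < 2 →
  ν₂ (A (t + h * 2) (t + h * 2 + (s + d * 2))) ≡ h * 3 + t * 2 + t * ν₂ (d + t) + ν₂ (A h (h + (d + t)))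
ν₂-A-halving h {t} d {s} t<2 s<2 = +-cancelʳ-≡ (d + ν₂ (d !)) _ _ (begin
    a₁ + (d + ν₂ (d !))                               ≡⟨ cong (a₁ +_) (ν₂-[r+k*2]! d s<2) ⟨
    a₁ + ν₂ ((s + d * 2) !)                           ≡⟨ ν₂-A l (s + d * 2) ⟩
    l + ν₂ ((l + (s + d * 2) + l) !)                  ≡⟨ cong (λ x → l + ν₂ (x !)) (outer h t d s) ⟩
    l + ν₂ ((s + w * 2) !)                            ≡⟨ cong (l +_) (ν₂-[r+k*2]! w s<2) ⟩
    l + (w + W)                                       ≡⟨ regroupˡ h t d W ⟩
    c + d + (h + W)                                   ≡⟨ cong (c + d +_) small ⟨
    c + d + (a₂ + ν₂ ((d + t) !))                     ≡⟨ cong (λ x → c + d + (a₂ + x)) (ν₂-[d+t]! d t<2) ⟩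
    c + d + (a₂ + (t * ν₂ (d + t) + ν₂ (d !)))        ≡⟨ regroupʳ c d a₂ (t * ν₂ (d + t)) (ν₂ (d !)) ⟩
    c + t * ν₂ (d + t) + a₂ + (d + ν₂ (d !))          ∎)
  where
  open ≡-Reasoning
  l a₁ a₂ c w W : ℕ
  l = t + h * 2
  a₁ = ν₂ (A l (l + (s + d * 2)))
  a₂ = ν₂ (A h (h + (d + t)))
  c = h * 3 + t * 2
  w = h * 2 + d + t
  W = ν₂ (w !)
  outer : ∀ h t d s → t + h * 2 + (s + d * 2) + (t + h * 2) ≡ s + (h * 2 + d + t) * 2
  outer = solve-∀
  inner : ∀ h d t → h + (d + t) + h ≡ h * 2 + d + t
  inner = solve-∀
  small : a₂ + ν₂ ((d + t) !) ≡ h + W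
  small = trans (ν₂-A h (d + t)) (cong (λ x → h + ν₂ (x !)) (inner h d t))
  regroupˡ : ∀ h t d W → t + h * 2 + (h * 2 + d + t + W) ≡ h * 3 + t * 2 + d + (h + W)
  regroupˡ = solve-∀
  regroupʳ : ∀ c d a x e → c + d + (a + (x + e)) ≡ c + x + a + (d + e)
  regroupʳ = solve-∀

halve : ∀ x → ∃₂ λ q r → r < 2 × x ≡ r + q * 2
halve x = x / 2 , x % 2 , m%n<n x 2 , m≡m%n+[m/n]*n x 2

[r+q*2]%2≡r : ∀ q {r} → r < 2 → (r + q * 2) % 2 ≡ r
[r+q*2]%2≡r q {r} r<2 = trans ([m+kn]%n≡m%n r q 2) (m<n⇒m%n≡m r<2)

[r+q*2]/2≡q : ∀ q {r} → r < 2 → (r + q * 2) / 2 ≡ q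
[r+q*2]/2≡q q {r} r<2 = begin
    (r + q * 2) / 2      ≡⟨ +-distrib-/ r (q * 2) (subst (_< 2) (sym r%2+q*2%2≡r) r<2) ⟩
    r / 2 + q * 2 / 2    ≡⟨ cong₂ _+_ (m<n⇒m/n≡0 r<2) (m*n/n≡m q 2) ⟩
    q                    ∎
  where
  open ≡-Reasoning
  r%2+q*2%2≡r : r % 2 + q * 2 % 2 ≡ r
  r%2+q*2%2≡r = trans (cong₂ _+_ (m<n⇒m%n≡m r<2) (m*n%n≡0 q 2)) (+-identityʳ r)

proposition4p1 : (m l : ℕ) → 1 ≤ m → l ≤ m →
    ν₂ (A l m) ≡
      (2 * l ∸ l / 2) + lam l * ν₂ ((m + lam l) / 2 ∸ l / 2) + ν₂ (A (l / 2) ((m + lam l) / 2))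
proposition4p1 m l _ l≤m with m≤n⇒∃[o]m+o≡n l≤m
... | n , refl with halve l | halve n
... | h , t , t<2 , refl | d , s , s<2 , refl = begin
    ν₂ (A l m)
  ≡⟨ ν₂-A-halving h d t<2 s<2 ⟩
    h * 3 + t * 2 + t * ν₂ (d + t) + ν₂ (A h M₀)
  ≡⟨ cong₂ (λ x y → x + t * ν₂ y + ν₂ (A h M₀)) 2l∸h≡h*3+t*2 (m+n∸m≡n h (d + t)) ⟨
    (2 * l ∸ h) + t * ν₂ (M₀ ∸ h) + ν₂ (A h M₀)
  ≡⟨ cong (λ M → (2 * l ∸ h) + t * ν₂ (M ∸ h) + ν₂ (A h M)) [m+t]/2≡M₀ ⟨
    rhs h t
  ≡⟨ cong₂ rhs ([r+q*2]/2≡q h t<2) ([r+q*2]%2≡r h t<2) ⟨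
    rhs (l / 2) (lam l)
  ∎
  where
  open ≡-Reasoning
  M₀ : ℕ
  M₀ = h + (d + t)
  rhs : ℕ → ℕ → ℕ
  rhs h′ t′ = (2 * l ∸ h′) + t′ * ν₂ ((m + t′) / 2 ∸ h′) + ν₂ (A h′ ((m + t′) / 2))
  [m+t]/2≡M₀ : (m + t) / 2 ≡ M₀
  [m+t]/2≡M₀ = trans (cong (_/ 2) (regroup h t d s)) ([r+q*2]/2≡q M₀ s<2)
    where regroup : ∀ h t d s → t + h * 2 + (s + d * 2) + t ≡ s + (h + (d + t)) * 2
          regroup = solve-∀
  2l∸h≡h*3+t*2 : 2 * l ∸ h ≡ h * 3 + t * 2
  2l∸h≡h*3+t*2 = trans (cong (_∸ h) (regroup h t)) (m+n∸n≡m (h * 3 + t * 2) h)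
    where regroup : ∀ h t → 2 * (t + h * 2) ≡ h * 3 + t * 2 + h
          regroup = solve-∀
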